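{- A connected finite graph $G$ is a monochrome of some exact Gallai clique if and only if there exists a full homomorphism from $G$ into the 5-cycle $C_5$.
   Context: Graphs are finite, undirected, loopless. An exact Gallai clique is an edge-colored complete graph in which every triangle has edges of exactly two distinct colors. For a colored graph $K=(V,E)$ and color $\alpha$, $K(\alpha)=(V,\{e:\overline e=\alpha\})$; a monochrome of $K$ is a connected component of some $K(\alpha)$, regarded as an uncolored graph. A full homomorphism $f:G\to H$ is a vertex map with $v_1v_2\in E_G\iff f(v_1)f(v_2)\in E_H$ for all $v_1,v_2$. -}

module Defs where

open import Data.Nat using (ℕ; suc)
open import Data.Fin using (Fin; zero; suc)
open import Data.Bool using (Bool; true; false)
open import Data.Product using (Σ; ∃; _×_; _,_)
open import Relation.Binary.PropositionalEquality using (_≡_; _≢_; refl)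
open import Data.Sum using (_⊎_)
open import Data.Empty using (⊥)
open import Function.Definitions using (Injective)
open import Level using (Level) renaming (suc to lsuc; zero to lzero)

record Graph (n : ℕ) : Set where
  field
    adj     : Fin n → Fin n → Bool
    sym     : ∀ u v → adj u v ≡ adj v u
    loopless : ∀ v → adj v v ≡ false
open Graph public

data Walk {n : ℕ} (G : Graph n) : Fin n → Fin n → Set where
  here : ∀ {u} → Walk G u u
  step : ∀ {u v w} → adj G u v ≡ true → Walk G v w → Walk G u w

Connected : {n : ℕ} → Graph n → Set
Connected {n} G = Fin n × (∀ u v → Walk G u v)

-- An edge-coloured complete graph on Fin m with colours in C
-- (the colour of the edge xy, x ≠ y, is col x y; diagonal values are irrelevant).
record ColouredClique (C : Set) (m : ℕ) : Set where
  field
    col    : Fin m → Fin m → C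
    colSym : ∀ x y → col x y ≡ col y x
open ColouredClique public

-- Every triangle has edges of exactly two distinct colours.
IsExactGallai : {C : Set} {m : ℕ} → ColouredClique C m → Set
IsExactGallai {C} {m} K =
  ∀ (x y z : Fin m) → x ≢ y → y ≢ z → x ≢ z →
    (col K x y ≡ col K y z ⊎ (col K y z ≡ col K x z ⊎ col K x y ≡ col K x z))
    × (col K x y ≡ col K y z → col K y z ≡ col K x z → ⊥)

ColourAdj : {C : Set} {m : ℕ} → ColouredClique C m → C → Fin m → Fin m → Set
ColourAdj K α x y = x ≢ y × col K x y ≡ α

-- G is (isomorphic to) a monochrome of K: there are a colour α and an
-- injective vertex map φ onto a connected component of K(α) which is an
-- isomorphism of G onto that component (as an induced subgraph of K(α)).
-- Since G is assumed connected, the image is connected in K(α); closure under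
-- α-edges makes it a full component.
IsMonochromeOf : {n : ℕ} → Graph n → {C : Set} {m : ℕ} → ColouredClique C m → Set
IsMonochromeOf {n} G {C} {m} K =
  Σ C λ α → Σ (Fin n → Fin m) λ φ →
      Injective _≡_ _≡_ φ
    × (∀ u v → adj G u v ≡ true → ColourAdj K α (φ u) (φ v))
    × (∀ u v → ColourAdj K α (φ u) (φ v) → adj G u v ≡ true)
    × (∀ u w → ColourAdj K α (φ u) w → ∃ λ v → φ v ≡ w)

IsGallaiMonochrome : {n : ℕ} → Graph n → Set₁
IsGallaiMonochrome G =
  Σ Set λ C → Σ ℕ λ m → Σ (ColouredClique C m) λ K →
    IsExactGallai K × IsMonochromeOf G K

C5adj : Fin 5 → Fin 5 → Bool
C5adj zero (suc zero) = true
C5adj (suc zero) zero = true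
C5adj (suc zero) (suc (suc zero)) = true
C5adj (suc (suc zero)) (suc zero) = true
C5adj (suc (suc zero)) (suc (suc (suc zero))) = true
C5adj (suc (suc (suc zero))) (suc (suc zero)) = true
C5adj (suc (suc (suc zero))) (suc (suc (suc (suc zero)))) = true
C5adj (suc (suc (suc (suc zero)))) (suc (suc (suc zero))) = true
C5adj (suc (suc (suc (suc zero)))) zero = true
C5adj zero (suc (suc (suc (suc zero)))) = true
C5adj _ _ = false

IsFullHom : {n k : ℕ} → Graph n → Graph k → (Fin n → Fin k) → Set
IsFullHom G H f = ∀ u v → adj G u v ≡ adj H (f u) (f v)

C5 : Graph 5
C5 = record { adj = C5adj ; sym = s ; loopless = l }
  where
    s : ∀ u v → C5adj u v ≡ C5adj v u
    s zero zero = refl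
    s zero (suc zero) = refl
    s zero (suc (suc zero)) = refl
    s zero (suc (suc (suc zero))) = refl
    s zero (suc (suc (suc (suc zero)))) = refl
    s (suc zero) zero = refl
    s (suc zero) (suc zero) = refl
    s (suc zero) (suc (suc zero)) = refl
    s (suc zero) (suc (suc (suc zero))) = refl
    s (suc zero) (suc (suc (suc (suc zero)))) = refl
    s (suc (suc zero)) zero = refl
    s (suc (suc zero)) (suc zero) = refl
    s (suc (suc zero)) (suc (suc zero)) = refl
    s (suc (suc zero)) (suc (suc (suc zero))) = refl
    s (suc (suc zero)) (suc (suc (suc (suc zero)))) = refl
    s (suc (suc (suc zero))) zero = refl
    s (suc (suc (suc zero))) (suc zero) = refl
    s (suc (suc (suc zero))) (suc (suc zero)) = refl
    s (suc (suc (suc zero))) (suc (suc (suc zero))) = refl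
    s (suc (suc (suc zero))) (suc (suc (suc (suc zero)))) = refl
    s (suc (suc (suc (suc zero)))) zero = refl
    s (suc (suc (suc (suc zero)))) (suc zero) = refl
    s (suc (suc (suc (suc zero)))) (suc (suc zero)) = refl
    s (suc (suc (suc (suc zero)))) (suc (suc (suc zero))) = refl
    s (suc (suc (suc (suc zero)))) (suc (suc (suc (suc zero)))) = refl
    l : ∀ v → C5adj v v ≡ false
    l zero = refl
    l (suc zero) = refl
    l (suc (suc zero)) = refl
    l (suc (suc (suc zero))) = refl
    l (suc (suc (suc (suc zero)))) = refl

-- If f is a full homomorphism to C5, colour a pair crossing two fibres of f
-- by its adjacency in C5 and a pair inside a fibre by the minimum of its
-- endpoints.  As neither C5 nor its complement contains a triangle, this is
-- an exact Gallai colouring, and G is its monochrome of colour `true`.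
--
-- Conversely, a monochrome G is triangle-free, and the colours c of its
-- non-edges satisfy c(p,r) = c(q,r) whenever pq is an edge and r is adjacent
-- to neither; moreover no independent triple is monochromatic.  So c(-,r) is
-- constant along paths avoiding the neighbourhood of r, which excludes
-- induced P5's and forces every vertex to be attached to a fixed induced
-- path x y z w exactly as some vertex of C5 is attached to the path 0 1 2 3;
-- that classification is a full homomorphism to C5.  If G has no induced P4
-- it is complete bipartite (or edgeless) and maps onto an edge of C5.
module Submission where

open import Defs
open import Data.Nat using (ℕ; _⊓_)
open import Data.Nat.Properties using (≤-total; ≤-trans; m≤n⇒m⊓n≡m; m≥n⇒m⊓n≡n; ⊓-sel; ⊓-comm)
open import Data.Fin using (Fin; toℕ)
open import Data.Fin.Patterns using (0F; 1F; 2F; 3F; 4F)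
open import Data.Fin.Properties using (toℕ-injective; all?; any?) renaming (_≟_ to _≟ᶠ_)
open import Data.Bool using (Bool; true; false; if_then_else_)
open import Data.Bool.Properties using (¬-not; not-¬) renaming (_≟_ to _≟ᵇ_)
open import Data.Product using (Σ; ∃; _×_; _,_; proj₁; proj₂)
open import Data.Sum using (_⊎_; inj₁; inj₂)
open import Data.Sum.Properties using (inj₁-injective; inj₂-injective)
import Data.Sum as Sum
open import Data.Empty using (⊥; ⊥-elim)
open import Function using (_∘_)
open import Function.Definitions using (Injective)
open import Relation.Nullary using (yes; no; ¬_; Dec; ¬?)
open import Relation.Nullary.Decidable using (_×-dec_; _→-dec_; from-yes; map′)
open import Relation.Binary.PropositionalEquality as ≡
  using (_≡_; _≢_; refl; trans; cong; ≢-sym; module ≡-Reasoning)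

TwoValued : {A : Set} → A → A → A → Set
TwoValued a b c = (a ≡ b ⊎ (b ≡ c ⊎ a ≡ c)) × (a ≡ b → b ≡ c → ⊥)

TwoValued-map : {A B : Set} {f : A → B} → Injective _≡_ _≡_ f →
                ∀ {a b c} → TwoValued a b c → TwoValued (f a) (f b) (f c)
TwoValued-map {f = f} f-inj (collision , notConstant) =
  Sum.map (cong f) (Sum.map (cong f) (cong f)) collision ,
  λ p q → notConstant (f-inj p) (f-inj q)

Bool-pigeonhole : ∀ (a b c : Bool) → a ≡ b ⊎ (b ≡ c ⊎ a ≡ c)
Bool-pigeonhole false false c     = inj₁ refl
Bool-pigeonhole false true  false = inj₂ (inj₂ refl)
Bool-pigeonhole false true  true  = inj₂ (inj₁ refl)
Bool-pigeonhole true  false false = inj₂ (inj₁ refl)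
Bool-pigeonhole true  false true  = inj₂ (inj₂ refl)
Bool-pigeonhole true  true  c     = inj₁ refl

⊓-pigeonhole : ∀ a b c → a ⊓ b ≡ b ⊓ c ⊎ (b ⊓ c ≡ a ⊓ c ⊎ a ⊓ b ≡ a ⊓ c)
⊓-pigeonhole a b c with ≤-total a b
... | inj₁ a≤b with ≤-total a c
...   | inj₁ a≤c = inj₂ (inj₂ (trans (m≤n⇒m⊓n≡m a≤b) (≡.sym (m≤n⇒m⊓n≡m a≤c))))
...   | inj₂ c≤a = inj₂ (inj₁ (trans (m≥n⇒m⊓n≡n (≤-trans c≤a a≤b)) (≡.sym (m≥n⇒m⊓n≡n c≤a))))
⊓-pigeonhole a b c | inj₂ b≤a with ≤-total b c
...   | inj₁ b≤c = inj₁ (trans (m≥n⇒m⊓n≡n b≤a) (≡.sym (m≤n⇒m⊓n≡m b≤c)))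
...   | inj₂ c≤b = inj₂ (inj₁ (trans (m≥n⇒m⊓n≡n c≤b) (≡.sym (m≥n⇒m⊓n≡n (≤-trans c≤b b≤a)))))

-- A common value of all three pairwise minima would equal two of a, b, c.
⊓-notConstant : ∀ {a b c} → a ≢ b → b ≢ c → a ≢ c → a ⊓ b ≡ b ⊓ c → b ⊓ c ≡ a ⊓ c → ⊥
⊓-notConstant {a} {b} {c} a≢b b≢c a≢c e₁ e₂ with ⊓-sel a b | ⊓-sel b c | ⊓-sel a c
... | inj₁ x | inj₁ y | _      = a≢b (trans (≡.sym x) (trans e₁ y))
... | inj₁ x | inj₂ y | _      = a≢c (trans (≡.sym x) (trans e₁ y))
... | inj₂ x | inj₁ y | inj₁ z = a≢b (≡.sym (trans (≡.sym y) (trans e₂ z)))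
... | inj₂ x | inj₁ y | inj₂ z = b≢c (trans (≡.sym y) (trans e₂ z))
... | inj₂ x | inj₂ y | _      = b≢c (trans (≡.sym x) (trans e₁ y))

⊓-twoValued : ∀ {a b c} → a ≢ b → b ≢ c → a ≢ c → TwoValued (a ⊓ b) (b ⊓ c) (a ⊓ c)
⊓-twoValued {a} {b} {c} a≢b b≢c a≢c = ⊓-pigeonhole a b c , ⊓-notConstant a≢b b≢c a≢c

module _ {n : ℕ} (G : Graph n) where

  TriangleFree : Set
  TriangleFree = ∀ {p q r} → adj G p q ≡ true → adj G q r ≡ true → adj G p r ≡ true → ⊥

  NoHomogeneousTriple : Set
  NoHomogeneousTriple = ∀ (i j k : Fin n) → i ≢ j → j ≢ k → i ≢ k →
    adj G i j ≡ adj G j k → adj G j k ≡ adj G i k → ⊥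

  record InducedP4 (x y z w : Fin n) : Set where
    constructor inducedP4
    field
      x∼y : adj G x y ≡ true
      y∼z : adj G y z ≡ true
      z∼w : adj G z w ≡ true
      x≁z : adj G x z ≡ false
      x≁w : adj G x w ≡ false
      y≁w : adj G y w ≡ false

  InducedP5 : Fin n → Fin n → Fin n → Fin n → Fin n → Set
  InducedP5 a b c d e =
    adj G a b ≡ true × adj G b c ≡ true × adj G c d ≡ true × adj G d e ≡ true ×
    adj G a c ≡ false × adj G a d ≡ false × adj G a e ≡ false ×
    adj G b d ≡ false × adj G b e ≡ false × adj G c e ≡ false

module GraphFacts {n : ℕ} (G : Graph n) where

  adj-sym : ∀ {p q b} → adj G p q ≡ b → adj G q p ≡ b
  adj-sym {p} {q} = trans (sym G q p)

  edge⇒distinct : ∀ {p q} → adj G p q ≡ true → p ≢ q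
  edge⇒distinct {p} pq refl = not-¬ pq (loopless G p)

  adjacency-distinguishes : ∀ {p q r} → adj G p r ≡ false → adj G q r ≡ true → p ≢ q
  adjacency-distinguishes pr qr refl = not-¬ qr pr

  commonNeighbour⇒nonadjacent : TriangleFree G →
    ∀ {u v s} → adj G u s ≡ true → adj G v s ≡ true → adj G u v ≡ false
  commonNeighbour⇒nonadjacent triangleFree us vs =
    ¬-not λ uv → triangleFree uv vs us

  InducedP4-reverse : ∀ {x y z w} → InducedP4 G x y z w → InducedP4 G w z y x
  InducedP4-reverse (inducedP4 x∼y y∼z z∼w x≁z x≁w y≁w) =
    inducedP4 (adj-sym z∼w) (adj-sym y∼z) (adj-sym x∼y) (adj-sym y≁w) (adj-sym x≁w) (adj-sym x≁z)

  inducedP4? : ∀ x y z w → Dec (InducedP4 G x y z w)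
  inducedP4? x y z w = map′
    (λ (x∼y , y∼z , z∼w , x≁z , x≁w , y≁w) → inducedP4 x∼y y∼z z∼w x≁z x≁w y≁w)
    (λ (inducedP4 x∼y y∼z z∼w x≁z x≁w y≁w) → x∼y , y∼z , z∼w , x≁z , x≁w , y≁w)
    ((adj G x y ≟ᵇ true) ×-dec (adj G y z ≟ᵇ true) ×-dec (adj G z w ≟ᵇ true) ×-dec
     (adj G x z ≟ᵇ false) ×-dec (adj G x w ≟ᵇ false) ×-dec (adj G y w ≟ᵇ false))

  Walk-transport : (P : Fin n → Set) → (∀ {u v} → P u → adj G u v ≡ true → P v) →
                   ∀ {u v} → P u → Walk G u v → P v
  Walk-transport P closed pu here         = pu
  Walk-transport P closed pu (step uv vw) = Walk-transport P closed (closed pu uv) vw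

C5-noHomogeneousTriple : NoHomogeneousTriple C5
C5-noHomogeneousTriple = from-yes (all? λ i → all? λ j → all? λ k →
  ¬? (i ≟ᶠ j) →-dec ¬? (j ≟ᶠ k) →-dec ¬? (i ≟ᶠ k) →-dec
  (C5adj i j ≟ᵇ C5adj j k) →-dec (C5adj j k ≟ᵇ C5adj i k) →-dec no λ ())

module FibreColouring {n k : ℕ} {G : Graph n} {H : Graph k}
                      (f : Fin n → Fin k) (f-full : IsFullHom G H f) where

  open GraphFacts G using (edge⇒distinct)

  Colour : Set
  Colour = Bool ⊎ ℕ

  colour : Fin n → Fin n → Colour
  colour x y with f x ≟ᶠ f y
  ... | yes _ = inj₂ (toℕ x ⊓ toℕ y)
  ... | no _  = inj₁ (adj H (f x) (f y))

  colour-sym : ∀ x y → colour x y ≡ colour y x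
  colour-sym x y with f x ≟ᶠ f y | f y ≟ᶠ f x
  ... | yes _   | yes _   = cong inj₂ (⊓-comm (toℕ x) (toℕ y))
  ... | no _    | no _    = cong inj₁ (sym H (f x) (f y))
  ... | yes fxy | no ¬fyx = ⊥-elim (¬fyx (≡.sym fxy))
  ... | no ¬fxy | yes fyx = ⊥-elim (¬fxy (≡.sym fyx))

  clique : ColouredClique Colour n
  clique = record { col = colour ; colSym = colour-sym }

  clique-exactGallai : NoHomogeneousTriple H → IsExactGallai clique
  clique-exactGallai noTriple x y z x≢y y≢z x≢z with f x ≟ᶠ f y | f y ≟ᶠ f z | f x ≟ᶠ f z
  ... | yes e₁ | yes e₂ | no  n₃ = ⊥-elim (n₃ (trans e₁ e₂))
  ... | yes e₁ | no  n₂ | yes e₃ = ⊥-elim (n₂ (trans (≡.sym e₁) e₃))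
  ... | no  n₁ | yes e₂ | yes e₃ = ⊥-elim (n₁ (trans e₃ (≡.sym e₂)))
  ... | yes e₁ | yes e₂ | yes e₃ =
      TwoValued-map inj₂-injective (⊓-twoValued (x≢y ∘ toℕ-injective) (y≢z ∘ toℕ-injective) (x≢z ∘ toℕ-injective))
  ... | yes e₁ | no  n₂ | no  n₃ =
      inj₂ (inj₁ (cong (λ t → inj₁ (adj H t (f z))) (≡.sym e₁))) , λ ()
  ... | no  n₁ | yes e₂ | no  n₃ =
      inj₂ (inj₂ (cong (λ t → inj₁ (adj H (f x) t)) e₂)) , λ ()
  ... | no  n₁ | no  n₂ | yes e₃ =
      inj₁ (cong inj₁ (trans (sym H (f x) (f y)) (cong (adj H (f y)) e₃))) , λ _ ()
  ... | no  n₁ | no  n₂ | no  n₃ =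
      TwoValued-map inj₁-injective
        (Bool-pigeonhole _ _ _ , noTriple (f x) (f y) (f z) n₁ n₂ n₃)

  edge⇒trueColoured : ∀ u v → adj G u v ≡ true → ColourAdj clique (inj₁ true) u v
  edge⇒trueColoured u v uv with f u ≟ᶠ f v
  ... | yes e = ⊥-elim (not-¬ uv (begin
        adj G u v           ≡⟨ f-full u v ⟩
        adj H (f u) (f v)   ≡⟨ cong (adj H (f u)) (≡.sym e) ⟩
        adj H (f u) (f u)   ≡⟨ loopless H (f u) ⟩
        false               ∎))
    where open ≡-Reasoning
  ... | no _  = edge⇒distinct uv , cong inj₁ (trans (≡.sym (f-full u v)) uv)

  trueColoured⇒edge : ∀ u v → ColourAdj clique (inj₁ true) u v → adj G u v ≡ true
  trueColoured⇒edge u v (_ , uv) with f u ≟ᶠ f v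
  ... | no _  = trans (f-full u v) (inj₁-injective uv)
  trueColoured⇒edge u v (_ , ()) | yes _

fullHom⇒gallaiMonochrome : ∀ {n k} {G : Graph n} {H : Graph k} → NoHomogeneousTriple H →
  Σ (Fin n → Fin k) (IsFullHom G H) → IsGallaiMonochrome G
fullHom⇒gallaiMonochrome {n} {G = G} {H = H} noTriple (f , f-full) =
  Colour , n , clique , clique-exactGallai noTriple ,
  inj₁ true , (λ v → v) , (λ e → e) , edge⇒trueColoured , trueColoured⇒edge , (λ _ w _ → w , refl)
  where open FibreColouring {G = G} {H = H} f f-full

record CompatibleColouring {n : ℕ} (G : Graph n) (C : Set) : Set where
  field
    colour     : Fin n → Fin n → C
    colour-sym : ∀ p q → colour p q ≡ colour q p
    transfer   : ∀ {p q r} → adj G p q ≡ true → adj G p r ≡ false → adj G q r ≡ false →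
                 colour p r ≡ colour q r
    noMonochromaticTriangle : ∀ {p q r} → p ≢ q → q ≢ r → p ≢ r →
                 colour p q ≡ colour q r → colour q r ≡ colour p r → ⊥

module _ {n m : ℕ} {G : Graph n} {C : Set} {K : ColouredClique C m}
         (exact : IsExactGallai K) where

  open GraphFacts G using (adj-sym; adjacency-distinguishes)

  monochrome⇒triangleFree : IsMonochromeOf G K → TriangleFree G
  monochrome⇒triangleFree (α , φ , _ , edge⇒α , _) {p} {q} {r} pq qr pr =
    proj₂ (exact (φ p) (φ q) (φ r) (proj₁ (edge⇒α p q pq)) (proj₁ (edge⇒α q r qr)) (proj₁ (edge⇒α p r pr)))
      (trans (proj₂ (edge⇒α p q pq)) (≡.sym (proj₂ (edge⇒α q r qr))))
      (trans (proj₂ (edge⇒α q r qr)) (≡.sym (proj₂ (edge⇒α p r pr))))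

  monochrome⇒compatibleColouring : IsMonochromeOf G K → CompatibleColouring G C
  monochrome⇒compatibleColouring (α , φ , φ-inj , edge⇒α , α⇒edge , _) = record
    { colour     = λ p q → col K (φ p) (φ q)
    ; colour-sym = λ p q → colSym K (φ p) (φ q)
    ; transfer   = transfer
    ; noMonochromaticTriangle = λ {p} {q} {r} p≢q q≢r p≢r →
        proj₂ (exact (φ p) (φ q) (φ r) (p≢q ∘ φ-inj) (q≢r ∘ φ-inj) (p≢r ∘ φ-inj))
    }
    where
    nonedge⇒notα : ∀ {p r} → adj G p r ≡ false → p ≢ r → col K (φ p) (φ r) ≢ α
    nonedge⇒notα pr p≢r pr≡α = not-¬ (α⇒edge _ _ (p≢r ∘ φ-inj , pr≡α)) pr

    transfer : ∀ {p q r} → adj G p q ≡ true → adj G p r ≡ false → adj G q r ≡ false →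
               col K (φ p) (φ r) ≡ col K (φ q) (φ r)
    transfer {p} {q} {r} pq pr qr =
      pick (proj₁ (exact (φ p) (φ q) (φ r) φp≢φq (q≢r ∘ φ-inj) (p≢r ∘ φ-inj)))
      where
      φp≢φq : φ p ≢ φ q
      φp≢φq = proj₁ (edge⇒α p q pq)
      pq≡α : col K (φ p) (φ q) ≡ α
      pq≡α = proj₂ (edge⇒α p q pq)
      q≢r : q ≢ r
      q≢r = ≢-sym (adjacency-distinguishes (adj-sym pr) (adj-sym pq))
      p≢r : p ≢ r
      p≢r = ≢-sym (adjacency-distinguishes (adj-sym qr) pq)

      pick : let c = λ u v → col K (φ u) (φ v) in
             c p q ≡ c q r ⊎ (c q r ≡ c p r ⊎ c p q ≡ c p r) → c p r ≡ c q r
      pick (inj₁ pq≡qr)        = ⊥-elim (nonedge⇒notα qr q≢r (trans (≡.sym pq≡qr) pq≡α))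
      pick (inj₂ (inj₁ qr≡pr)) = ≡.sym qr≡pr
      pick (inj₂ (inj₂ pq≡pr)) = ⊥-elim (nonedge⇒notα pr p≢r (trans (≡.sym pq≡pr) pq≡α))

module P4Free {n : ℕ} {G : Graph n} (connected : ∀ u v → Walk G u v)
              (triangleFree : TriangleFree G) (noP4 : ∀ x y z w → ¬ InducedP4 G x y z w)
              {a b : Fin n} (a∼b : adj G a b ≡ true) where

  open GraphFacts G

  dominatingEdge : ∀ v → adj G v a ≡ true ⊎ adj G v b ≡ true
  dominatingEdge v = Walk-transport (λ u → adj G u a ≡ true ⊎ adj G u b ≡ true) extend (inj₂ a∼b) (connected a v)
    where
    extend : ∀ {u t} → adj G u a ≡ true ⊎ adj G u b ≡ true → adj G u t ≡ true →
             adj G t a ≡ true ⊎ adj G t b ≡ true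
    extend {t = t} _ _ with adj G t a in t∼a | adj G t b in t∼b
    ... | true  | _    = inj₁ refl
    ... | false | true = inj₂ refl
    extend (inj₁ u∼a) u∼t | false | false = ⊥-elim (noP4 _ _ _ _
      (inducedP4 (adj-sym u∼t) u∼a a∼b t∼a t∼b (commonNeighbour⇒nonadjacent triangleFree u∼a (adj-sym a∼b))))
    extend (inj₂ u∼b) u∼t | false | false = ⊥-elim (noP4 _ _ _ _
      (inducedP4 (adj-sym u∼t) u∼b (adj-sym a∼b) t∼b t∼a (commonNeighbour⇒nonadjacent triangleFree u∼b a∼b)))

  nonNeighbour-of-b⇒neighbour-of-a : ∀ {v} → adj G v b ≡ false → adj G v a ≡ true
  nonNeighbour-of-b⇒neighbour-of-a {v} v≁b with dominatingEdge v
  ... | inj₁ v∼a = v∼a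
  ... | inj₂ v∼b = ⊥-elim (not-¬ v∼b v≁b)

  neighbour-of-b∼nonNeighbour-of-b : ∀ {u v} → adj G u b ≡ true → adj G v b ≡ false → adj G u v ≡ true
  neighbour-of-b∼nonNeighbour-of-b u∼b v≁b = ¬-not λ u≁v → noP4 _ _ _ _
    (inducedP4 u∼b (adj-sym a∼b) (adj-sym (nonNeighbour-of-b⇒neighbour-of-a v≁b))
               (commonNeighbour⇒nonadjacent triangleFree u∼b a∼b) u≁v (adj-sym v≁b))

  bipartition-fullHom : ∀ {k} (H : Graph k) {i j} → adj H i j ≡ true →
                        IsFullHom G H (λ v → if adj G v b then i else j)
  bipartition-fullHom H {i} {j} i∼j u v with adj G u b in u∼b | adj G v b in v∼b
  ... | true  | true  = trans (commonNeighbour⇒nonadjacent triangleFree u∼b v∼b) (≡.sym (loopless H i))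
  ... | true  | false = trans (neighbour-of-b∼nonNeighbour-of-b u∼b v∼b) (≡.sym i∼j)
  ... | false | true  = trans (adj-sym (neighbour-of-b∼nonNeighbour-of-b v∼b u∼b)) (≡.sym (trans (sym H j i) i∼j))
  ... | false | false = trans (commonNeighbour⇒nonadjacent triangleFree
                               (nonNeighbour-of-b⇒neighbour-of-a u∼b) (nonNeighbour-of-b⇒neighbour-of-a v∼b))
                             (≡.sym (loopless H j))

P4-free⇒fullHom : ∀ {n k} {G : Graph n} → (∀ u v → Walk G u v) → TriangleFree G →
  (∀ x y z w → ¬ InducedP4 G x y z w) → (H : Graph k) → ∀ {i j} → adj H i j ≡ true →
  Σ (Fin n → Fin k) (IsFullHom G H)
P4-free⇒fullHom {G = G} connected triangleFree noP4 H {i} i∼j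
  with any? (λ a → any? λ b → adj G a b ≟ᵇ true)
... | yes (a , b , a∼b) = _ , P4Free.bipartition-fullHom connected triangleFree noP4 a∼b H i∼j
... | no edgeless = (λ _ → i) , λ u v → trans (¬-not λ u∼v → edgeless (u , v , u∼v)) (≡.sym (loopless H i))

module AroundInducedP4 {n : ℕ} {G : Graph n} (triangleFree : TriangleFree G)
                       {C : Set} (κ : CompatibleColouring G C) where

  open GraphFacts G
  open CompatibleColouring κ

  transferʳ : ∀ {p q r} → adj G p q ≡ true → adj G p r ≡ false → adj G q r ≡ false →
              colour r p ≡ colour r q
  transferʳ {p} {q} {r} p∼q p≁r q≁r =
    trans (colour-sym r p) (trans (transfer p∼q p≁r q≁r) (colour-sym q r))

  notMonochromatic : ∀ {p q r} → p ≢ q → q ≢ r → p ≢ r →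
                     colour p q ≡ colour p r → colour q r ≡ colour p r → ⊥
  notMonochromatic p≢q q≢r p≢r pq≡pr qr≡pr =
    noMonochromaticTriangle p≢q q≢r p≢r (trans pq≡pr (≡.sym qr≡pr)) qr≡pr

  noInducedP5 : ∀ {a b c d e} → ¬ InducedP5 G a b c d e
  noInducedP5 (a∼b , b∼c , c∼d , d∼e , a≁c , a≁d , a≁e , b≁d , b≁e , c≁e) =
    notMonochromatic (adjacency-distinguishes a≁d c∼d)
                     (≢-sym (adjacency-distinguishes (adj-sym b≁e) (adj-sym b∼c)))
                     (≢-sym (adjacency-distinguishes (adj-sym b≁e) a∼b))
                     (trans (transferʳ c∼d (adj-sym a≁c) (adj-sym a≁d)) (transferʳ d∼e (adj-sym a≁d) (adj-sym a≁e)))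
                     (trans (transfer (adj-sym b∼c) c≁e b≁e) (transfer (adj-sym a∼b) b≁e a≁e))

  InClass : (x y z w v : Fin n) → Fin 5 → Set
  InClass x y z w v i =
    adj G v x ≡ C5adj i 0F × adj G v y ≡ C5adj i 1F × adj G v z ≡ C5adj i 2F × adj G v w ≡ C5adj i 3F

  Detached : (x y z w v : Fin n) → Set
  Detached x y z w v = adj G v x ≡ false × adj G v y ≡ false × adj G v z ≡ false × adj G v w ≡ false

  reflect : Fin 5 → Fin 5
  reflect 0F = 3F
  reflect 1F = 2F
  reflect 2F = 1F
  reflect 3F = 0F
  reflect 4F = 4F

  InClass-reverse : ∀ {x y z w v} i → InClass x y z w v i → InClass w z y x v (reflect i)
  InClass-reverse 0F (vx , vy , vz , vw) = vw , vz , vy , vx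
  InClass-reverse 1F (vx , vy , vz , vw) = vw , vz , vy , vx
  InClass-reverse 2F (vx , vy , vz , vw) = vw , vz , vy , vx
  InClass-reverse 3F (vx , vy , vz , vw) = vw , vz , vy , vx
  InClass-reverse 4F (vx , vy , vz , vw) = vw , vz , vy , vx

  module _ {x y z w : Fin n} (P : InducedP4 G x y z w) where

    open InducedP4 P
    open ≡-Reasoning

    xw≡uw : ∀ {u} → adj G u y ≡ true → adj G u w ≡ false → colour x w ≡ colour u w
    xw≡uw u∼y u≁w = trans (transfer x∼y x≁w y≁w) (≡.sym (transfer u∼y u≁w y≁w))

    class0-adj-class1 : ∀ {u v} → InClass x y z w u 0F → InClass x y z w v 1F → adj G u v ≡ true
    class0-adj-class1 {u} {v} (u≁x , u∼y , u≁z , u≁w) (v∼x , _ , v∼z , _) =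
      ¬-not λ u≁v → absurd u≁v (u ≟ᶠ x)
      where
      absurd : adj G u v ≡ false → Dec (u ≡ x) → ⊥
      absurd u≁v (yes refl) = not-¬ v∼x (adj-sym u≁v)
      absurd u≁v (no u≢x) = notMonochromatic (≢-sym u≢x) (adjacency-distinguishes u≁w z∼w)
                                             (adjacency-distinguishes x≁w z∼w) xu≡xz uz≡xz
        where
        uz≡xz : colour u z ≡ colour x z
        uz≡xz = begin
          colour u z  ≡⟨ transferʳ z∼w (adj-sym u≁z) (adj-sym u≁w) ⟩
          colour u w  ≡⟨ xw≡uw u∼y u≁w ⟨
          colour x w  ≡⟨ transferʳ (adj-sym z∼w) (adj-sym x≁w) (adj-sym x≁z) ⟩
          colour x z  ∎
        xu≡xz : colour x u ≡ colour x z
        xu≡xz = begin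
          colour x u  ≡⟨ transfer (adj-sym v∼x) (adj-sym u≁x) (adj-sym u≁v) ⟩
          colour v u  ≡⟨ transfer v∼z (adj-sym u≁v) (adj-sym u≁z) ⟩
          colour z u  ≡⟨ colour-sym z u ⟩
          colour u z  ≡⟨ uz≡xz ⟩
          colour x z  ∎

    class1-adj-class2 : ∀ {u v} → InClass x y z w u 1F → InClass x y z w v 2F → adj G u v ≡ true
    class1-adj-class2 {u} {v} (u∼x , u≁y , _ , u≁w) (_ , v∼y , _ , v∼w) =
      ¬-not λ u≁v → absurd u≁v (u ≟ᶠ y)
      where
      absurd : adj G u v ≡ false → Dec (u ≡ y) → ⊥
      absurd u≁v (yes refl) = not-¬ v∼y (adj-sym u≁v)
      absurd u≁v (no u≢y) = notMonochromatic (adjacency-distinguishes (adj-sym x≁w) u∼x) u≢y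
                                             (adjacency-distinguishes (adj-sym x≁w) (adj-sym x∼y)) wu≡wy uy≡wy
        where
        wu≡wy : colour w u ≡ colour w y
        wu≡wy = begin
          colour w u  ≡⟨ colour-sym w u ⟩
          colour u w  ≡⟨ transfer u∼x u≁w x≁w ⟩
          colour x w  ≡⟨ transfer x∼y x≁w y≁w ⟩
          colour y w  ≡⟨ colour-sym y w ⟩
          colour w y  ∎
        uy≡wy : colour u y ≡ colour w y
        uy≡wy = begin
          colour u y  ≡⟨ colour-sym u y ⟩
          colour y u  ≡⟨ transfer v∼y (adj-sym u≁v) (adj-sym u≁y) ⟨
          colour v u  ≡⟨ transfer v∼w (adj-sym u≁v) (adj-sym u≁w) ⟩
          colour w u  ≡⟨ wu≡wy ⟩
          colour w y  ∎

    class0-adj-class4 : ∀ {u v} → InClass x y z w u 0F → InClass x y z w v 4F → adj G u v ≡ true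
    class0-adj-class4 {u} {v} (u≁x , u∼y , u≁z , u≁w) (v∼x , _ , _ , v∼w) =
      ¬-not λ u≁v → absurd u≁v (u ≟ᶠ x)
      where
      absurd : adj G u v ≡ false → Dec (u ≡ x) → ⊥
      absurd u≁v (yes refl) = not-¬ v∼x (adj-sym u≁v)
      absurd u≁v (no u≢x) = notMonochromatic u≢x (≢-sym (adjacency-distinguishes (adj-sym y≁w) x∼y))
                                             (adjacency-distinguishes u≁z (adj-sym z∼w))
                                             ux≡uw (xw≡uw u∼y u≁w)
        where
        ux≡uw : colour u x ≡ colour u w
        ux≡uw = begin
          colour u x  ≡⟨ colour-sym u x ⟩
          colour x u  ≡⟨ transfer v∼x (adj-sym u≁v) (adj-sym u≁x) ⟨
          colour v u  ≡⟨ transfer v∼w (adj-sym u≁v) (adj-sym u≁w) ⟩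
          colour w u  ≡⟨ colour-sym w u ⟩
          colour u w  ∎

    class0-nonadj-class3 : ∀ {u v} → InClass x y z w u 0F → InClass x y z w v 3F → adj G u v ≡ false
    class0-nonadj-class3 {u} {v} (u≁x , u∼y , u≁z , u≁w) (v≁x , _ , v∼z , _) =
      ¬-not λ u∼v → notMonochromatic (≢-sym (adjacency-distinguishes (adj-sym v≁x) u∼v))
                                     (≢-sym (adjacency-distinguishes (adj-sym y≁w) x∼y))
                                     (adjacency-distinguishes u≁z (adj-sym z∼w))
                                     (ux≡uw u∼v) (xw≡uw u∼y u≁w)
      where
      ux≡uw : adj G u v ≡ true → colour u x ≡ colour u w
      ux≡uw u∼v = begin
        colour u x  ≡⟨ transfer u∼v u≁x v≁x ⟩
        colour v x  ≡⟨ transfer v∼z v≁x (adj-sym x≁z) ⟩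
        colour z x  ≡⟨ transfer z∼w (adj-sym x≁z) (adj-sym x≁w) ⟩
        colour w x  ≡⟨ colour-sym w x ⟩
        colour x w  ≡⟨ xw≡uw u∼y u≁w ⟩
        colour u w  ∎

    class1-neighbour-notDetached : ∀ {u t} → InClass x y z w u 1F → adj G u t ≡ true →
                                   ¬ Detached x y z w t
    class1-neighbour-notDetached {u} {t} (u∼x , _ , _ , u≁w) u∼t (t≁x , t≁y , t≁z , t≁w) =
      notMonochromatic (adjacency-distinguishes t≁x (adj-sym x∼y))
                       (≢-sym (adjacency-distinguishes (adj-sym x≁w) (adj-sym x∼y)))
                       (adjacency-distinguishes t≁z (adj-sym z∼w))
                       ty≡tw yw≡tw
      where
      ty≡tw : colour t y ≡ colour t w
      ty≡tw = begin
        colour t y  ≡⟨ colour-sym t y ⟩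
        colour y t  ≡⟨ transfer y∼z (adj-sym t≁y) (adj-sym t≁z) ⟩
        colour z t  ≡⟨ transfer z∼w (adj-sym t≁z) (adj-sym t≁w) ⟩
        colour w t  ≡⟨ colour-sym w t ⟩
        colour t w  ∎
      yw≡tw : colour y w ≡ colour t w
      yw≡tw = begin
        colour y w  ≡⟨ transfer x∼y x≁w y≁w ⟨
        colour x w  ≡⟨ transfer (adj-sym u∼x) x≁w u≁w ⟩
        colour u w  ≡⟨ transfer u∼t u≁w t≁w ⟩
        colour t w  ∎

  module Classification (connected : ∀ u v → Walk G u v)
                        {x y z w : Fin n} (P : InducedP4 G x y z w) where

    open InducedP4 P

    P′ : InducedP4 G w z y x
    P′ = InducedP4-reverse P

    share : ∀ {u v s} → adj G u s ≡ true → adj G v s ≡ true → adj G u v ≡ false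
    share = commonNeighbour⇒nonadjacent triangleFree

    classOrDetached : ∀ v → Detached x y z w v ⊎ ∃ (InClass x y z w v)
    classOrDetached v with adj G v x in vx | adj G v y in vy | adj G v z in vz | adj G v w in vw
    ... | false | false | false | false = inj₁ (refl , refl , refl , refl)
    ... | false | true  | false | false = inj₂ (0F , refl , refl , refl , refl)
    ... | true  | false | true  | false = inj₂ (1F , refl , refl , refl , refl)
    ... | false | true  | false | true  = inj₂ (2F , refl , refl , refl , refl)
    ... | false | false | true  | false = inj₂ (3F , refl , refl , refl , refl)
    ... | true  | false | false | true  = inj₂ (4F , refl , refl , refl , refl)
    ... | true  | true  | _     | _     = ⊥-elim (triangleFree vx x∼y vy)
    ... | _     | true  | true  | _     = ⊥-elim (triangleFree vy y∼z vz)
    ... | _     | _     | true  | true  = ⊥-elim (triangleFree vz z∼w vw)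
    ... | true  | false | false | false = ⊥-elim (noInducedP5
          (vx , x∼y , y∼z , z∼w , vy , vz , vw , x≁z , x≁w , y≁w))
    ... | false | false | false | true  = ⊥-elim (noInducedP5
          (vw , adj-sym z∼w , adj-sym y∼z , adj-sym x∼y , vz , vy , vx , adj-sym y≁w , adj-sym x≁w , adj-sym x≁z))

    neighbour-notDetached : ∀ {u t} i → InClass x y z w u i → adj G u t ≡ true → ¬ Detached x y z w t
    neighbour-notDetached 0F (_ , u∼y , u≁z , u≁w) u∼t (_ , t≁y , t≁z , t≁w) = noInducedP5
      (adj-sym u∼t , u∼y , y∼z , z∼w , t≁y , t≁z , t≁w , u≁z , u≁w , y≁w)
    neighbour-notDetached 1F u-class u∼t t-detached =
      class1-neighbour-notDetached P u-class u∼t t-detached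
    neighbour-notDetached 2F u-class u∼t (t≁x , t≁y , t≁z , t≁w) =
      class1-neighbour-notDetached P′ (InClass-reverse 2F u-class) u∼t (t≁w , t≁z , t≁y , t≁x)
    neighbour-notDetached 3F (u≁x , u≁y , u∼z , _) u∼t (t≁x , t≁y , t≁z , _) = noInducedP5
      (adj-sym u∼t , u∼z , adj-sym y∼z , adj-sym x∼y , t≁z , t≁y , t≁x , u≁y , u≁x , adj-sym x≁z)
    neighbour-notDetached 4F (u∼x , u≁y , u≁z , _) u∼t (t≁x , t≁y , t≁z , _) = noInducedP5
      (adj-sym u∼t , u∼x , x∼y , y∼z , t≁x , t≁y , t≁z , u≁y , u≁z , x≁z)

    classOf : ∀ v → ∃ (InClass x y z w v)
    classOf v = Walk-transport (λ u → ∃ (InClass x y z w u)) extend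
                               (0F , loopless G x , x∼y , x≁z , x≁w) (connected x v)
      where
      extend : ∀ {u t} → ∃ (InClass x y z w u) → adj G u t ≡ true → ∃ (InClass x y z w t)
      extend {t = t} (i , u-class) u∼t with classOrDetached t
      ... | inj₁ t-detached = ⊥-elim (neighbour-notDetached i u-class u∼t t-detached)
      ... | inj₂ t-class    = t-class

    -- Two classes whose C5-vertices have a common neighbour among 0 1 2 3
    -- have a common neighbour on the path.
    adjacency-byClass : ∀ {u v} i j → InClass x y z w u i → InClass x y z w v j → adj G u v ≡ C5adj i j
    adjacency-byClass 0F 0F (_ , u∼y , _) (_ , v∼y , _) = share u∼y v∼y
    adjacency-byClass 0F 1F u-class v-class = class0-adj-class1 P u-class v-class
    adjacency-byClass 0F 2F (_ , u∼y , _) (_ , v∼y , _) = share u∼y v∼y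
    adjacency-byClass 0F 3F u-class v-class = class0-nonadj-class3 P u-class v-class
    adjacency-byClass 0F 4F u-class v-class = class0-adj-class4 P u-class v-class
    adjacency-byClass 1F 0F u-class v-class = adj-sym (class0-adj-class1 P v-class u-class)
    adjacency-byClass 1F 1F (u∼x , _) (v∼x , _) = share u∼x v∼x
    adjacency-byClass 1F 2F u-class v-class = class1-adj-class2 P u-class v-class
    adjacency-byClass 1F 3F (_ , _ , u∼z , _) (_ , _ , v∼z , _) = share u∼z v∼z
    adjacency-byClass 1F 4F (u∼x , _) (v∼x , _) = share u∼x v∼x
    adjacency-byClass 2F 0F (_ , u∼y , _) (_ , v∼y , _) = share u∼y v∼y
    adjacency-byClass 2F 1F u-class v-class = adj-sym (class1-adj-class2 P v-class u-class)
    adjacency-byClass 2F 2F (_ , u∼y , _) (_ , v∼y , _) = share u∼y v∼y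
    adjacency-byClass 2F 3F u-class v-class =
      adj-sym (class0-adj-class1 P′ (InClass-reverse 3F v-class) (InClass-reverse 2F u-class))
    adjacency-byClass 2F 4F (_ , _ , _ , u∼w) (_ , _ , _ , v∼w) = share u∼w v∼w
    adjacency-byClass 3F 0F u-class v-class = adj-sym (class0-nonadj-class3 P v-class u-class)
    adjacency-byClass 3F 1F (_ , _ , u∼z , _) (_ , _ , v∼z , _) = share u∼z v∼z
    adjacency-byClass 3F 2F u-class v-class =
      class0-adj-class1 P′ (InClass-reverse 3F u-class) (InClass-reverse 2F v-class)
    adjacency-byClass 3F 3F (_ , _ , u∼z , _) (_ , _ , v∼z , _) = share u∼z v∼z
    adjacency-byClass 3F 4F u-class v-class =
      class0-adj-class4 P′ (InClass-reverse 3F u-class) (InClass-reverse 4F v-class)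
    adjacency-byClass 4F 0F u-class v-class = adj-sym (class0-adj-class4 P v-class u-class)
    adjacency-byClass 4F 1F (u∼x , _) (v∼x , _) = share u∼x v∼x
    adjacency-byClass 4F 2F (_ , _ , _ , u∼w) (_ , _ , _ , v∼w) = share u∼w v∼w
    adjacency-byClass 4F 3F u-class v-class =
      adj-sym (class0-adj-class4 P′ (InClass-reverse 3F v-class) (InClass-reverse 4F u-class))
    adjacency-byClass 4F 4F (u∼x , _) (v∼x , _) = share u∼x v∼x

    classOf-fullHom : IsFullHom G C5 (proj₁ ∘ classOf)
    classOf-fullHom u v = adjacency-byClass (proj₁ (classOf u)) (proj₁ (classOf v))
                                            (proj₂ (classOf u)) (proj₂ (classOf v))

triangleFree-compatible⇒fullHomC5 : ∀ {n} {G : Graph n} {C : Set} → (∀ u v → Walk G u v) →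
  TriangleFree G → CompatibleColouring G C → Σ (Fin n → Fin 5) (IsFullHom G C5)
triangleFree-compatible⇒fullHomC5 {G = G} connected triangleFree κ
  with any? (λ x → any? λ y → any? λ z → any? λ w → GraphFacts.inducedP4? G x y z w)
... | yes (_ , _ , _ , _ , P) = proj₁ ∘ classOf , classOf-fullHom
  where open AroundInducedP4.Classification triangleFree κ connected P
... | no noP4 = P4-free⇒fullHom connected triangleFree (λ x y z w P → noP4 (x , y , z , w , P)) C5 {0F} {1F} refl

mainTheorem18 : ∀ {n : ℕ} (G : Graph n) → Connected G →
    (IsGallaiMonochrome G → Σ (Fin n → Fin 5) (IsFullHom G C5))
    × (Σ (Fin n → Fin 5) (IsFullHom G C5) → IsGallaiMonochrome G)
mainTheorem18 G (_ , connected) =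
  (λ (_ , _ , K , exact , monochrome) →
     triangleFree-compatible⇒fullHomC5 connected (monochrome⇒triangleFree {G = G} {K = K} exact monochrome)
                                                 (monochrome⇒compatibleColouring {G = G} {K = K} exact monochrome)) ,
  fullHom⇒gallaiMonochrome {G = G} {H = C5} C5-noHomogeneousTriple
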